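{- Let $(L,\Delta)$ be an LL lattice with $\Delta : \hat{0} = x_0 \prec x_1 \prec \cdots \prec x_n = \hat{1}$ and $A_n \neq \emptyset$. Let $b \in A_n$, set $x_i' = x_i \vee b$ for $0 \le i \le n-1$ (so $b = x_0' \le x_1' \le \cdots \le x_{n-1}' = \hat{1}$), and let $\Delta'$ consist of the distinct elements of this multichain. Then $([b,\hat{1}],\Delta')$ is an LL lattice. Furthermore, $|A_i| = |A_i'|$ for $1 \le i \le n-1$, where $A_i' = \{a \in A(b,\hat{1}) : a \le x_i' \text{ but } a \not\le x_{i-1}'\}$ and $A(b,\hat{1})$ is the set of atoms of the interval $[b,\hat{1}]$.
   Context: $L$ is a finite lattice with atom set $A$. For a maximal chain $\Delta: \hat{0} = x_0 \prec x_1 \prec \cdots \prec x_n = \hat{1}$, the $i$th level is $A_i = \{a \in A : a \le x_i,\ a \not\le x_{i-1}\}$, and $A$ is partially ordered by $a \lhd b$ iff $a \in A_i$, $b \in A_j$ with $i<j$. $(L,\Delta)$ satisfies the level condition if whenever $a \lhd b_1 \lhd b_2 \lhd \cdots \lhd b_k$ in $A$, we have $a \not\le \bigvee_{i=1}^k b_i$. An element $x$ is left-modular if for all $y,z \in L$ with $z<y$ one has $z\vee(x\wedge y) = (z\vee x)\wedge y$. $(L,\Delta)$ is an LL lattice if every element of $\Delta$ is left-modular and the level condition holds. For $([b,\hat{1}],\Delta')$ the levels, order on atoms and level condition are defined analogously using the atoms of $[b,\hat{1}]$ and the chain $\Delta'$. -}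

module Defs where

open import Level using (0ℓ)
open import Data.Nat using (ℕ; zero; suc)
open import Data.Fin using (Fin; zero; suc; inject₁; fromℕ) renaming (_<_ to _<ᶠ_)
open import Data.Fin.Properties using (_≟_; all?)
open import Data.List using (List; []; _∷_; length; filter)
open import Data.List using () renaming (allFin to allFinL)
open import Data.Product using (Σ; ∃; _×_; _,_)
open import Data.Empty using (⊥)
open import Data.Unit using (⊤)
open import Relation.Nullary using (¬_; Dec; yes; no; _×-dec_; ¬?)
open import Relation.Unary using (Pred; Decidable)
open import Relation.Binary using (Rel)
open import Relation.Binary.PropositionalEquality using (_≡_; _≢_)
open import Algebra.Core using (Op₂)
open import Relation.Binary.Lattice.Structures using (IsBoundedLattice)

-- A finite lattice, presented (up to isomorphism) on the carrier Fin N,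
-- with decidable order.  Equality is propositional equality on Fin N.
record FinLattice : Set₁ where
  field
    N   : ℕ
    _≤_ : Rel (Fin N) 0ℓ
    _≤?_ : (x y : Fin N) → Dec (x ≤ y)
    _∨_ : Op₂ (Fin N)
    _∧_ : Op₂ (Fin N)
    ⊤̂   : Fin N
    ⊥̂   : Fin N
    isBoundedLattice : IsBoundedLattice _≡_ _≤_ _∨_ _∧_ ⊤̂ ⊥̂

module LatticeNotions (L : FinLattice) where
  open FinLattice L public

  C : Set
  C = Fin N

  infix 4 _<_ _⋖_

  _<_ : C → C → Set
  x < y = (x ≤ y) × (x ≢ y)

  _<?_ : (x y : C) → Dec (x < y)
  x <? y = (x ≤? y) ×-dec ¬? (x ≟ y)

  _⋖_ : C → C → Set
  x ⋖ y = (x < y) × (∀ z → ¬ ((x < z) × (z < y)))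

  _⋖?_ : (x y : C) → Dec (x ⋖ y)
  x ⋖? y = (x <? y) ×-dec all? (λ z → ¬? ((x <? z) ×-dec (z <? y)))

  Atom : C → C → Set
  Atom lo a = lo ⋖ a

  count : {P : Pred C 0ℓ} → Decidable P → ℕ
  count P? = length (filter P? (allFinL N))

  MaxChain : (lo : C) (k : ℕ) → (Fin (suc k) → C) → Set
  MaxChain lo k Δ =
    (Δ zero ≡ lo) × (Δ (fromℕ k) ≡ ⊤̂) × (∀ (i : Fin k) → Δ (inject₁ i) ⋖ Δ (suc i))

  -- Level i (0-based, i : Fin k) is the paper's level A_{i+1}:
  -- atoms a of [lo , ⊤̂] with a ≤ x_{i+1} and a ≰ x_i.
  Level : (lo : C) {k : ℕ} → (Fin (suc k) → C) → Fin k → C → Set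
  Level lo Δ i a = Atom lo a × (a ≤ Δ (suc i)) × ¬ (a ≤ Δ (inject₁ i))

  level? : (lo : C) {k : ℕ} (Δ : Fin (suc k) → C) (i : Fin k) → Decidable (Level lo Δ i)
  level? lo Δ i a = (lo ⋖? a) ×-dec ((a ≤? Δ (suc i)) ×-dec ¬? (a ≤? Δ (inject₁ i)))

  ◁ : (lo : C) {k : ℕ} → (Fin (suc k) → C) → C → C → Set
  ◁ lo {k} Δ a b = Σ (Fin k) λ i → Σ (Fin k) λ j →
    (i <ᶠ j) × Level lo Δ i a × Level lo Δ j b

  ◁-chain : (lo : C) {k : ℕ} → (Fin (suc k) → C) → C → List C → Set
  ◁-chain lo Δ b [] = ⊤
  ◁-chain lo Δ b (c ∷ cs) = ◁ lo Δ b c × ◁-chain lo Δ c cs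

  ⋁ : C → List C → C
  ⋁ b [] = b
  ⋁ b (c ∷ cs) = b ∨ ⋁ c cs

  LevelCondition : (lo : C) {k : ℕ} → (Fin (suc k) → C) → Set
  LevelCondition lo Δ = ∀ a b₁ bs → ◁ lo Δ a b₁ → ◁-chain lo Δ b₁ bs → ¬ (a ≤ ⋁ b₁ bs)

  LeftModular : (lo : C) → C → Set
  LeftModular lo x = ∀ y z → lo ≤ y → lo ≤ z → z < y → (z ∨ (x ∧ y)) ≡ ((z ∨ x) ∧ y)

  IsLL : (lo : C) (k : ℕ) → (Fin (suc k) → C) → Set
  IsLL lo k Δ = MaxChain lo k Δ × (∀ i → LeftModular lo (Δ i)) × LevelCondition lo Δ

{-# OPTIONS --safe #-}
module Submission where

-- Since x_{i-1} ⋖ x_i with x_i left-modular, x_{i-1} ∨ b is equal to or covered by x_i ∨ b, so the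
-- x_i ∨ b without repetitions form a maximal chain of [b, 1̂]; left-modularity passes from x to x ∨ b.
-- The level condition applied to d ◁ a ◁ b gives x_q ∧ (a ∨ b) = 0̂ for every atom a ≤ x_{n-1} with
-- a ≰ x_q. Together with left-modularity this makes a ↦ a ∨ b a bijection from A_i onto A_i′ with
-- inverse c ↦ x_i ∧ c, and shows that every atom of [b, 1̂] is a ∨ b for an atom a ≤ x_{n-1}.
-- Pulling a chain c ◁′ d₁ ◁′ ⋯ ◁′ d_k back along this correspondence and appending b turns a
-- violation of the level condition in [b, 1̂] into one in L.

open import Level using (0ℓ)
open import Data.Nat using (ℕ; zero; suc; z≤n; s≤s) renaming (_≤_ to _≤ⁿ_; _<_ to _<ⁿ_)
open import Data.Nat.Properties using (≰⇒>; ≮⇒≥; <-≤-trans)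
open import Data.Fin using (Fin; zero; suc; inject₁; fromℕ; toℕ) renaming (_≤_ to _≤ᶠ_)
open import Data.Fin.Properties using (_≟_; toℕ-inject₁; toℕ-fromℕ; inject₁ℕ<)
open import Data.List using (List; []; _∷_; [_]; _++_; length; filter; map; allFin)
open import Data.List.Properties using (length-map; map-∘; map-id-local)
import Data.List.Relation.Unary.All as All
open import Data.List.Relation.Unary.All.Properties using (all-filter)
open import Data.List.Relation.Unary.Unique.Propositional using (Unique)
open import Data.List.Relation.Unary.Unique.Propositional.Properties using (filter⁺; allFin⁺; map⁻)
open import Data.List.Membership.Propositional using (_∈_)
open import Data.List.Membership.Propositional.Properties
  using (∈-map⁺; ∈-map⁻; ∈-filter⁺; ∈-filter⁻; ∈-allFin)
open import Data.List.Membership.Propositional.Properties.WithK using (unique∧set⇒bag)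
open import Data.List.Relation.Binary.BagAndSetEquality using (∼bag⇒↭)
open import Data.List.Relation.Binary.Permutation.Propositional.Properties using (↭-length)
open import Data.Product using (Σ; ∃; _×_; _,_; proj₁; proj₂) renaming (map to Σ-map)
open import Data.Sum using (_⊎_; inj₁; inj₂)
open import Data.Empty using (⊥-elim)
open import Data.Unit using (tt)
open import Data.Vec.Functional using () renaming (_∷_ to _◂_)
open import Function using (_∘_; id)
open import Function.Bundles using (_⇔_; mk⇔; Equivalence)
open import Relation.Nullary using (¬_; yes; no; ¬?)
open import Relation.Nullary.Decidable using (decidable-stable)
open import Relation.Unary using (Pred; Decidable)
open import Relation.Binary using (Rel; Preorder)
open import Relation.Binary.Lattice using (BoundedLattice)
import Relation.Binary.Reasoning.PartialOrder as ≤-Reasoning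
open import Relation.Binary.PropositionalEquality
  using (_≡_; _≢_; refl; sym; trans; cong; subst; module ≡-Reasoning)

open import Defs

count-≡ : ∀ {n} {P Q : Pred (Fin n) 0ℓ} (P? : Decidable P) (Q? : Decidable Q)
  (f g : Fin n → Fin n) → (∀ {a} → P a → Q (f a)) → (∀ {c} → Q c → P (g c)) →
  (∀ {a} → P a → g (f a) ≡ a) → (∀ {c} → Q c → f (g c) ≡ c) →
  length (filter P? (allFin n)) ≡ length (filter Q? (allFin n))
count-≡ {n} {P} {Q} P? Q? f g f∈Q g∈P g∘f≡id f∘g≡id = begin
  length xs          ≡⟨ sym (length-map f xs) ⟩
  length (map f xs)  ≡⟨ ↭-length (∼bag⇒↭ (unique∧set⇒bag map-f-unique ys-unique same-members)) ⟩
  length ys          ∎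
  where
  open ≡-Reasoning
  xs ys : List (Fin n)
  xs = filter P? (allFin n)
  ys = filter Q? (allFin n)
  ys-unique : Unique ys
  ys-unique = filter⁺ Q? (allFin⁺ n)
  map-g-map-f : map g (map f xs) ≡ xs
  map-g-map-f = trans (sym (map-∘ xs)) (map-id-local (All.map g∘f≡id (all-filter P? (allFin n))))
  map-f-unique : Unique (map f xs)
  map-f-unique = map⁻ (subst Unique (sym map-g-map-f) (filter⁺ P? (allFin⁺ n)))
  same-members : ∀ {z} → z ∈ map f xs ⇔ z ∈ ys
  same-members = mk⇔ to from
    where
    to : ∀ {z} → z ∈ map f xs → z ∈ ys
    to z∈ with ∈-map⁻ f z∈
    ... | a , a∈xs , refl = ∈-filter⁺ Q? (∈-allFin _) (f∈Q (proj₂ (∈-filter⁻ P? {xs = allFin n} a∈xs)))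
    from : ∀ {z} → z ∈ ys → z ∈ map f xs
    from {z} z∈ = subst (_∈ map f xs) (f∘g≡id Qz) (∈-map⁺ f (∈-filter⁺ P? (∈-allFin _) (g∈P Qz)))
      where
      Qz : Q z
      Qz = proj₂ (∈-filter⁻ Q? {xs = allFin n} z∈)

crossing : ∀ {k} (Q : Pred (Fin (suc k)) 0ℓ) → Decidable Q → ¬ Q zero → Q (fromℕ k) →
           ∃ λ i → ¬ Q (inject₁ i) × Q (suc i)
crossing {zero}  Q Q? ¬Q₀ Qₖ = ⊥-elim (¬Q₀ Qₖ)
crossing {suc k} Q Q? ¬Q₀ Qₖ with Q? (suc zero)
... | yes Q₁ = zero , ¬Q₀ , Q₁
... | no ¬Q₁ = Σ-map suc id (crossing (Q ∘ suc) (Q? ∘ suc) ¬Q₁ Qₖ)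

≤⇒≤inject₁ : ∀ {k} {p : Fin (suc k)} {i : Fin k} → p ≤ᶠ i → p ≤ᶠ inject₁ i
≤⇒≤inject₁ {i = i} = subst (_ ≤ⁿ_) (sym (toℕ-inject₁ i))

module _ {c ℓ₁ ℓ₂} (P : Preorder c ℓ₁ ℓ₂) where
  open Preorder P using (Carrier; _≲_) renaming (refl to ≲-refl; trans to ≲-trans)

  stepwise-mono : ∀ {k} (f : Fin (suc k) → Carrier) → (∀ i → f (inject₁ i) ≲ f (suc i)) →
                  ∀ {p q} → p ≤ᶠ q → f p ≲ f q
  stepwise-mono         f step {zero}  {zero}  _ = ≲-refl
  stepwise-mono {suc k} f step {zero}  {suc q} _ =
    ≲-trans (step zero) (stepwise-mono (f ∘ suc) (step ∘ suc) {zero} {q} z≤n)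
  stepwise-mono {suc k} f step {suc p} {suc q} (s≤s p≤q) =
    stepwise-mono (f ∘ suc) (step ∘ suc) p≤q

module _ {A : Set} where
  SameImage : ∀ {k s} → (Fin k → A) → (Fin s → A) → Set
  SameImage g f = ∀ y → (∃ λ j → g j ≡ y) ⇔ (∃ λ i → f i ≡ y)

  same-image-tail : ∀ {k s} {g : Fin k → A} {f : Fin (suc (suc s)) → A} →
                    f zero ≡ f (suc zero) → SameImage g (f ∘ suc) → SameImage g f
  same-image-tail {g = g} {f} f₀≡f₁ im y = mk⇔ to from
    where
    to : (∃ λ j → g j ≡ y) → ∃ λ i → f i ≡ y
    to = Σ-map suc id ∘ Equivalence.to (im y)
    from : (∃ λ i → f i ≡ y) → ∃ λ j → g j ≡ y
    from (zero  , f₀≡y) = Equivalence.from (im y) (zero , trans (sym f₀≡f₁) f₀≡y)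
    from (suc i , fᵢ≡y) = Equivalence.from (im y) (i , fᵢ≡y)

  same-image-∷ : ∀ {k s} {g : Fin k → A} {f : Fin (suc s) → A} →
                 SameImage g (f ∘ suc) → SameImage (f zero ◂ g) f
  same-image-∷ {g = g} {f} im y = mk⇔ to from
    where
    to : (∃ λ j → (f zero ◂ g) j ≡ y) → ∃ λ i → f i ≡ y
    to (zero  , f₀≡y) = zero , f₀≡y
    to (suc j , gⱼ≡y) = Σ-map suc id (Equivalence.to (im y) (j , gⱼ≡y))
    from : (∃ λ i → f i ≡ y) → ∃ λ j → (f zero ◂ g) j ≡ y
    from (zero  , f₀≡y) = zero , f₀≡y
    from (suc i , fᵢ≡y) = Σ-map suc id (Equivalence.from (im y) (i , fᵢ≡y))

  record Squashed (R : Rel A 0ℓ) {s} (f : Fin (suc s) → A) : Set where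
    field
      len   : ℕ
      chain : Fin (suc len) → A
      first : chain zero ≡ f zero
      last  : chain (fromℕ len) ≡ f (fromℕ s)
      steps : ∀ i → R (chain (inject₁ i)) (chain (suc i))
      image : SameImage chain f

  squash : (R : Rel A 0ℓ) {s : ℕ} (f : Fin (suc s) → A) →
           (∀ i → f (inject₁ i) ≡ f (suc i) ⊎ R (f (inject₁ i)) (f (suc i))) → Squashed R f
  squash R {zero} f step = record
    { len = zero ; chain = f ; first = refl ; last = refl ; steps = λ () ; image = λ y → mk⇔ id id }
  squash R {suc s} f step with squash R (f ∘ suc) (step ∘ suc) | step zero
  ... | sq | inj₁ f₀≡f₁ = record
    { Squashed sq ; first = trans (Squashed.first sq) (sym f₀≡f₁)
    ; image = same-image-tail f₀≡f₁ (Squashed.image sq) }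
  ... | sq | inj₂ Rf₀f₁ = record
    { len = suc len ; chain = f zero ◂ chain ; first = refl ; last = last
    ; steps = λ { zero → subst (R (f zero)) (sym first) Rf₀f₁ ; (suc i) → steps i }
    ; image = same-image-∷ image }
    where open Squashed sq

module LatticeFacts (L : FinLattice) where
  -- LatticeNotions gives these operators no fixity; re-export them with the standard library's.
  open LatticeNotions L public hiding (_≤_; _∨_; _∧_)
  open LatticeNotions L public using () renaming (_≤_ to infix 4 _≤_; _∨_ to infixr 6 _∨_; _∧_ to infixr 7 _∧_)

  boundedLattice : BoundedLattice 0ℓ 0ℓ 0ℓ
  boundedLattice = record { isBoundedLattice = isBoundedLattice }

  open BoundedLattice boundedLattice public
    using (poset; preorder; x≤x∨y; y≤x∨y; ∨-least; x∧y≤x; x∧y≤y; ∧-greatest; maximum; minimum)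
    renaming (refl to ≤-refl; reflexive to ≤-reflexive; trans to ≤-trans; antisym to ≤-antisym)
  open import Relation.Binary.Lattice.Properties.JoinSemilattice (BoundedLattice.joinSemilattice boundedLattice)
    public using (∨-comm; ∨-monotonic; x≤y⇒x∨y≈y)
  open import Relation.Binary.Lattice.Properties.MeetSemilattice (BoundedLattice.meetSemilattice boundedLattice)
    public using (∧-monotonic; y≤x⇒x∧y≈y)
  open import Relation.Binary.Lattice.Properties.BoundedLattice boundedLattice public using (∧-zeroˡ)

  y≤x⇒x∨y≡x : ∀ {x y} → y ≤ x → x ∨ y ≡ x
  y≤x⇒x∨y≡x {x} {y} y≤x = trans (∨-comm x y) (x≤y⇒x∨y≈y y≤x)

  ≡⊥̂⇒≤ : ∀ {x y} → x ≡ ⊥̂ → x ≤ y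
  ≡⊥̂⇒≤ {y = y} refl = minimum y

  ≤⊥̂⇒≡ : ∀ {x} → x ≤ ⊥̂ → x ≡ ⊥̂
  ≤⊥̂⇒≡ {x} x≤⊥̂ = ≤-antisym x≤⊥̂ (minimum x)

  ⋖-interval : ∀ {x y v} → x ⋖ y → x ≤ v → v ≤ y → v ≡ x ⊎ v ≡ y
  ⋖-interval {x} {y} {v} (_ , nothing-between) x≤v v≤y with v ≟ x | v ≟ y
  ... | yes v≡x | _       = inj₁ v≡x
  ... | no _    | yes v≡y = inj₂ v≡y
  ... | no v≢x  | no v≢y  = ⊥-elim (nothing-between v ((x≤v , v≢x ∘ sym) , (v≤y , v≢y)))

  ⋖-∨-split : ∀ {x y v} → x ⋖ y → v ≤ y → v ≤ x ⊎ x ∨ v ≡ y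
  ⋖-∨-split {x} {y} {v} x⋖y v≤y with ⋖-interval x⋖y (x≤x∨y x v) (∨-least (proj₁ (proj₁ x⋖y)) v≤y)
  ... | inj₁ x∨v≡x = inj₁ (≤-trans (y≤x∨y x v) (≤-reflexive x∨v≡x))
  ... | inj₂ x∨v≡y = inj₂ x∨v≡y

  atom-≤⇒≡ : ∀ {lo a c} → Atom lo a → Atom lo c → a ≤ c → a ≡ c
  atom-≤⇒≡ ((lo≤a , lo≢a) , _) c-atom a≤c with ⋖-interval c-atom lo≤a a≤c
  ... | inj₁ a≡lo = ⊥-elim (lo≢a (sym a≡lo))
  ... | inj₂ a≡c  = a≡c

  modular-inequality : ∀ {x y z} → z ≤ y → z ∨ (x ∧ y) ≤ (z ∨ x) ∧ y
  modular-inequality {x} {y} {z} z≤y =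
    ∧-greatest (∨-monotonic ≤-refl (x∧y≤x x y)) (∨-least z≤y (x∧y≤y x y))

  left-modular-gap : ∀ {x y z} → LeftModular ⊥̂ x → z < y → x ∧ y ≤ z → ¬ (y ≤ x ∨ z)
  left-modular-gap {x} {y} {z} x-lm z<y x∧y≤z y≤x∨z = proj₂ z<y (begin
    z                ≡⟨ sym (y≤x⇒x∨y≡x x∧y≤z) ⟩
    z ∨ (x ∧ y)      ≡⟨ x-lm y z (minimum y) (minimum z) z<y ⟩
    (z ∨ x) ∧ y      ≡⟨ y≤x⇒x∧y≈y (≤-trans y≤x∨z (≤-reflexive (∨-comm x z))) ⟩
    y                ∎)
    where open ≡-Reasoning

  left-modular-∨ : ∀ {x} b → LeftModular ⊥̂ x → LeftModular b (x ∨ b)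
  left-modular-∨ {x} b x-lm y z b≤y b≤z z<y = ≤-antisym (modular-inequality (proj₁ z<y)) (begin
    (z ∨ x ∨ b) ∧ y  ≤⟨ ∧-monotonic (∨-least (x≤x∨y z x) (∨-least (y≤x∨y z x) (≤-trans b≤z (x≤x∨y z x)))) ≤-refl ⟩
    (z ∨ x) ∧ y      ≡⟨ sym (x-lm y z (minimum y) (minimum z) z<y) ⟩
    z ∨ (x ∧ y)      ≤⟨ ∨-monotonic ≤-refl (∧-monotonic (x≤x∨y x b) ≤-refl) ⟩
    z ∨ (x ∨ b) ∧ y  ∎)
    where open ≤-Reasoning poset

  ⋖-∨ : ∀ {x y} b → LeftModular ⊥̂ y → x ⋖ y → x ∨ b ≡ y ∨ b ⊎ x ∨ b ⋖ y ∨ b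
  ⋖-∨ {x} {y} b y-lm x⋖y@((x≤y , _) , _) with x ∨ b ≟ y ∨ b
  ... | yes x∨b≡y∨b = inj₁ x∨b≡y∨b
  ... | no  x∨b≢y∨b = inj₂ ((∨-monotonic x≤y ≤-refl , x∨b≢y∨b) , nothing-between)
    where
    nothing-between : ∀ w → ¬ ((x ∨ b < w) × (w < y ∨ b))
    nothing-between w (x∨b<w@(x∨b≤w , _) , (w≤y∨b , w≢y∨b))
      with ⋖-interval x⋖y (∧-greatest x≤y (≤-trans (x≤x∨y x b) x∨b≤w)) (x∧y≤x y w)
    ... | inj₂ y∧w≡y = w≢y∨b (≤-antisym w≤y∨b
            (∨-least (≤-trans (≤-reflexive (sym y∧w≡y)) (x∧y≤y y w)) (≤-trans (y≤x∨y x b) x∨b≤w)))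
    ... | inj₁ y∧w≡x = left-modular-gap y-lm x∨b<w
            (≤-trans (≤-reflexive y∧w≡x) (x≤x∨y x b))
            (≤-trans w≤y∨b (∨-monotonic ≤-refl (y≤x∨y x b)))

  ≤-⋁-last : ∀ x xs y → y ≤ ⋁ x (xs ++ [ y ])
  ≤-⋁-last x []        y = y≤x∨y x y
  ≤-⋁-last x (x′ ∷ xs) y = ≤-trans (≤-⋁-last x′ xs y) (y≤x∨y x _)

  ◁-atoms : ∀ {lo k} (Δ : Fin (suc k) → C) {c d} → ◁ lo Δ c d → Atom lo c × Atom lo d
  ◁-atoms _ (_ , _ , _ , (c-atom , _) , (d-atom , _)) = c-atom , d-atom

  module MonotoneChain {k} (Δ : Fin (suc k) → C) (Δ-step : ∀ i → Δ (inject₁ i) ≤ Δ (suc i)) where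
    Δ-mono : ∀ {p q} → p ≤ᶠ q → Δ p ≤ Δ q
    Δ-mono = stepwise-mono preorder Δ Δ-step

    Separated : C → C → Set
    Separated a e = ∃ λ p → a ≤ Δ p × ¬ (e ≤ Δ p)

    ◁⇒separated : ∀ {lo a e} → ◁ lo Δ a e → Separated a e
    ◁⇒separated (i , j , i<j , (_ , a≤Δᵢ₊₁ , _) , (_ , _ , e≰Δⱼ)) =
      suc i , a≤Δᵢ₊₁ , λ e≤Δᵢ₊₁ → e≰Δⱼ (≤-trans e≤Δᵢ₊₁ (Δ-mono (≤⇒≤inject₁ i<j)))

    module _ {lo} (Δ-first : Δ zero ≡ lo) (Δ-last : Δ (fromℕ k) ≡ ⊤̂) where
      level-of : ∀ {a} → Atom lo a → ∃ λ i → Level lo Δ i a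
      level-of {a} a-atom@((lo≤a , lo≢a) , _) with crossing (λ i → a ≤ Δ i) (λ i → a ≤? Δ i) a≰Δ₀ a≤Δₖ
        where
        a≰Δ₀ : ¬ (a ≤ Δ zero)
        a≰Δ₀ a≤Δ₀ = lo≢a (≤-antisym lo≤a (≤-trans a≤Δ₀ (≤-reflexive Δ-first)))
        a≤Δₖ : a ≤ Δ (fromℕ k)
        a≤Δₖ = ≤-trans (maximum a) (≤-reflexive (sym Δ-last))
      ... | i , a≰Δᵢ , a≤Δᵢ₊₁ = i , a-atom , a≤Δᵢ₊₁ , a≰Δᵢ

      separated⇒◁ : ∀ {a e} → Atom lo a → Atom lo e → Separated a e → ◁ lo Δ a e
      separated⇒◁ a-atom e-atom (p , a≤Δₚ , e≰Δₚ) with level-of a-atom | level-of e-atom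
      ... | i , a-level@(_ , _ , a≰Δᵢ) | j , e-level@(_ , e≤Δⱼ₊₁ , _) =
        i , j , <-≤-trans i<p p≤j , a-level , e-level
        where
        i<p : toℕ i <ⁿ toℕ p
        i<p = ≰⇒> (λ p≤i → a≰Δᵢ (≤-trans a≤Δₚ (Δ-mono (≤⇒≤inject₁ p≤i))))
        p≤j : toℕ p ≤ⁿ toℕ j
        p≤j = ≮⇒≥ (λ j<p → e≰Δₚ (≤-trans e≤Δⱼ₊₁ (Δ-mono j<p)))

  -- Where Δ i ∧ u = ⊥̂ ≠ Δ (i + 1) ∧ u, left-modularity of Δ i makes Δ (i + 1) ∧ u an atom.
  atom-below : ∀ {k} {Δ : Fin (suc k) → C} → MaxChain ⊥̂ k Δ → (∀ i → LeftModular ⊥̂ (Δ i)) →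
               ∀ u → u ≢ ⊥̂ → ∃ λ a → Atom ⊥̂ a × a ≤ u
  atom-below {k} {Δ} (Δ-first , Δ-last , Δ-cover) Δ-lm u u≢⊥̂
    with crossing (λ i → Δ i ∧ u ≢ ⊥̂) (λ i → ¬? (Δ i ∧ u ≟ ⊥̂))
                  (λ Δ₀∧u≢⊥̂ → Δ₀∧u≢⊥̂ Δ₀∧u≡⊥̂) (λ Δₖ∧u≡⊥̂ → u≢⊥̂ (trans (sym Δₖ∧u≡u) Δₖ∧u≡⊥̂))
    where
    Δ₀∧u≡⊥̂ : Δ zero ∧ u ≡ ⊥̂
    Δ₀∧u≡⊥̂ = trans (cong (_∧ u) Δ-first) (∧-zeroˡ u)
    Δₖ∧u≡u : Δ (fromℕ k) ∧ u ≡ u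
    Δₖ∧u≡u = trans (cong (_∧ u) Δ-last) (y≤x⇒x∧y≈y (maximum u))
  ... | i , ¬Δᵢ∧u≢⊥̂ , Δᵢ₊₁∧u≢⊥̂ =
    Δ (suc i) ∧ u , ((minimum _ , Δᵢ₊₁∧u≢⊥̂ ∘ sym) , nothing-between) , x∧y≤y _ u
    where
    x y : C
    x = Δ (inject₁ i)
    y = Δ (suc i)
    x∧u≡⊥̂ : x ∧ u ≡ ⊥̂
    x∧u≡⊥̂ = decidable-stable (x ∧ u ≟ ⊥̂) ¬Δᵢ∧u≢⊥̂
    nothing-between : ∀ v → ¬ ((⊥̂ < v) × (v < y ∧ u))
    nothing-between v ((_ , ⊥̂≢v) , v<y∧u@(v≤y∧u , _))
      with ⋖-∨-split (Δ-cover i) (≤-trans v≤y∧u (x∧y≤x y u))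
    ... | inj₁ v≤x = ⊥̂≢v (sym (≤⊥̂⇒≡
            (≤-trans (∧-greatest v≤x (≤-trans v≤y∧u (x∧y≤y y u))) (≤-reflexive x∧u≡⊥̂))))
    ... | inj₂ x∨v≡y = left-modular-gap (Δ-lm (inject₁ i)) v<y∧u
            (≤-trans (∧-monotonic ≤-refl (x∧y≤y y u)) (≡⊥̂⇒≤ x∧u≡⊥̂))
            (≤-trans (x∧y≤x y u) (≤-reflexive (sym x∨v≡y)))

  module TopLevelAtom (m : ℕ) (Δ : Fin (suc (suc m)) → C) (Δ-LL : IsLL ⊥̂ (suc m) Δ)
                      (b : C) (b-top : Level ⊥̂ Δ (fromℕ m) b) where
    Δ-maxchain : MaxChain ⊥̂ (suc m) Δ
    Δ-maxchain = proj₁ Δ-LL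

    Δ-first : Δ zero ≡ ⊥̂
    Δ-first = proj₁ Δ-maxchain

    Δ-last : Δ (fromℕ (suc m)) ≡ ⊤̂
    Δ-last = proj₁ (proj₂ Δ-maxchain)

    Δ-cover : ∀ i → Δ (inject₁ i) ⋖ Δ (suc i)
    Δ-cover = proj₂ (proj₂ Δ-maxchain)

    Δ-step : ∀ i → Δ (inject₁ i) ≤ Δ (suc i)
    Δ-step i = proj₁ (proj₁ (Δ-cover i))

    Δ-lm : ∀ i → LeftModular ⊥̂ (Δ i)
    Δ-lm = proj₁ (proj₂ Δ-LL)

    Δ-level-condition : LevelCondition ⊥̂ Δ
    Δ-level-condition = proj₂ (proj₂ Δ-LL)

    open MonotoneChain Δ Δ-step using (Δ-mono; separated⇒◁)

    -- the paper's x_{n-1}, with n = m + 1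
    xₘ : C
    xₘ = Δ (inject₁ (fromℕ m))

    b-atom : Atom ⊥̂ b
    b-atom = proj₁ b-top

    b≰xₘ : ¬ (b ≤ xₘ)
    b≰xₘ = proj₂ (proj₂ b-top)

    xₘ∨b≡⊤̂ : xₘ ∨ b ≡ ⊤̂
    xₘ∨b≡⊤̂ with ⋖-∨-split (Δ-cover (fromℕ m)) (≤-trans (maximum b) (≤-reflexive (sym Δ-last)))
    ... | inj₁ b≤xₘ    = ⊥-elim (b≰xₘ b≤xₘ)
    ... | inj₂ xₘ∨b≡Δₗ = trans xₘ∨b≡Δₗ Δ-last

    ≤xₘ⇒≢b : ∀ {a} → a ≤ xₘ → a ≢ b
    ≤xₘ⇒≢b a≤xₘ refl = b≰xₘ a≤xₘ

    b<a∨b : ∀ {a} → Atom ⊥̂ a → a ≤ xₘ → b < a ∨ b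
    b<a∨b {a} a-atom a≤xₘ = y≤x∨y a b , λ b≡a∨b →
      ≤xₘ⇒≢b a≤xₘ (atom-≤⇒≡ a-atom b-atom (≤-trans (x≤x∨y a b) (≤-reflexive (sym b≡a∨b))))

    a<a∨b : ∀ {a} → Atom ⊥̂ a → a ≤ xₘ → a < a ∨ b
    a<a∨b {a} a-atom a≤xₘ = x≤x∨y a b , λ a≡a∨b →
      ≤xₘ⇒≢b a≤xₘ (sym (atom-≤⇒≡ b-atom a-atom (≤-trans (y≤x∨y a b) (≤-reflexive (sym a≡a∨b)))))

    ◁b : ∀ {a} → Atom ⊥̂ a → a ≤ xₘ → ◁ ⊥̂ Δ a b
    ◁b a-atom a≤xₘ = separated⇒◁ Δ-first Δ-last a-atom b-atom (inject₁ (fromℕ m) , a≤xₘ , b≰xₘ)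

    -- An atom d below both Δ q and a ∨ b would give d ◁ a ◁ b with d ≤ a ∨ b.
    meet-∨b≡⊥̂ : ∀ {a} q → Atom ⊥̂ a → a ≤ xₘ → ¬ (a ≤ Δ q) → Δ q ∧ (a ∨ b) ≡ ⊥̂
    meet-∨b≡⊥̂ {a} q a-atom a≤xₘ a≰Δq = decidable-stable (Δ q ∧ (a ∨ b) ≟ ⊥̂) λ meet≢⊥̂ →
      let d , d-atom , d≤meet = atom-below Δ-maxchain Δ-lm _ meet≢⊥̂ in
      Δ-level-condition d a [ b ]
        (separated⇒◁ Δ-first Δ-last d-atom a-atom (q , ≤-trans d≤meet (x∧y≤x _ _) , a≰Δq))
        (◁b a-atom a≤xₘ , tt)
        (≤-trans d≤meet (x∧y≤y _ _))

    ∨b-reflects-≤ : ∀ {a} q → Atom ⊥̂ a → a ≤ xₘ → a ∨ b ≤ Δ q ∨ b → a ≤ Δ q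
    ∨b-reflects-≤ {a} q a-atom a≤xₘ a∨b≤Δq∨b = decidable-stable (a ≤? Δ q) λ a≰Δq →
      left-modular-gap (Δ-lm q) (b<a∨b a-atom a≤xₘ) (≡⊥̂⇒≤ (meet-∨b≡⊥̂ q a-atom a≤xₘ a≰Δq)) a∨b≤Δq∨b

    atom-∨b-preimage : ∀ {c} q → Δ q ≤ xₘ → Atom b c → c ≤ Δ q ∨ b →
                       ∃ λ a → Atom ⊥̂ a × a ≤ Δ q × a ∨ b ≡ c
    atom-∨b-preimage {c} q Δq≤xₘ c-atom@(b<c@(b≤c , _) , _) c≤Δq∨b
      with atom-below Δ-maxchain Δ-lm (Δ q ∧ c)
             (λ Δq∧c≡⊥̂ → left-modular-gap (Δ-lm q) b<c (≡⊥̂⇒≤ Δq∧c≡⊥̂) c≤Δq∨b)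
    ... | a , a-atom , a≤Δq∧c = a , a-atom , a≤Δq , a∨b≡c
      where
      a≤Δq : a ≤ Δ q
      a≤Δq = ≤-trans a≤Δq∧c (x∧y≤x (Δ q) c)
      a∨b≡c : a ∨ b ≡ c
      a∨b≡c with ⋖-interval c-atom (y≤x∨y a b) (∨-least (≤-trans a≤Δq∧c (x∧y≤y (Δ q) c)) b≤c)
      ... | inj₁ a∨b≡b = ⊥-elim (proj₂ (b<a∨b a-atom (≤-trans a≤Δq Δq≤xₘ)) (sym a∨b≡b))
      ... | inj₂ a∨b≡c = a∨b≡c

    AtomPreimage : C → C → Set
    AtomPreimage c a = Atom ⊥̂ a × a ≤ xₘ × a ∨ b ≡ c

    atom-preimage : ∀ {c} → Atom b c → ∃ (AtomPreimage c)
    atom-preimage {c} c-atom =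
      atom-∨b-preimage (inject₁ (fromℕ m)) ≤-refl c-atom (≤-trans (maximum c) (≤-reflexive (sym xₘ∨b≡⊤̂)))

    x′ : Fin (suc m) → C
    x′ i = Δ (inject₁ i) ∨ b

    module LevelConditionAbove {k} (Δ′ : Fin (suc k) → C) (Δ′-step : ∀ i → Δ′ (inject₁ i) ≤ Δ′ (suc i))
                               (Δ′-in-x′ : ∀ j → ∃ λ i → x′ i ≡ Δ′ j) where
      ◁-preimage : ∀ {c d a e} → ◁ b Δ′ c d → AtomPreimage c a → AtomPreimage d e → ◁ ⊥̂ Δ a e
      ◁-preimage c◁d (a-atom , a≤xₘ , refl) (e-atom , _ , refl)
        with MonotoneChain.◁⇒separated Δ′ Δ′-step c◁d
      ... | p , a∨b≤Δ′ₚ , e∨b≰Δ′ₚ with Δ′-in-x′ p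
      ...   | i , x′ᵢ≡Δ′ₚ = separated⇒◁ Δ-first Δ-last a-atom e-atom
                (inject₁ i , ∨b-reflects-≤ (inject₁ i) a-atom a≤xₘ (≤-trans a∨b≤Δ′ₚ (≤-reflexive (sym x′ᵢ≡Δ′ₚ))) ,
                 λ e≤Δᵢ → e∨b≰Δ′ₚ (≤-trans (∨-monotonic e≤Δᵢ ≤-refl) (≤-reflexive x′ᵢ≡Δ′ₚ)))

      ◁-chain-preimage : ∀ {d e} ds → AtomPreimage d e → ◁-chain b Δ′ d ds →
                         ∃ λ es → ◁-chain ⊥̂ Δ e (es ++ [ b ]) × ⋁ d ds ≤ ⋁ e (es ++ [ b ])
      ◁-chain-preimage [] (e-atom , e≤xₘ , e∨b≡d) tt = [] , (◁b e-atom e≤xₘ , tt) , ≤-reflexive (sym e∨b≡d)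
      ◁-chain-preimage {e = e} (d′ ∷ ds) e-pre@(_ , _ , refl) (d◁d′ , d′-chain)
        with atom-preimage (proj₂ (◁-atoms Δ′ d◁d′))
      ... | e′ , e′-pre with ◁-chain-preimage ds e′-pre d′-chain
      ...   | es , e′-chain , ⋁ds≤ =
        e′ ∷ es , (◁-preimage d◁d′ e-pre e′-pre , e′-chain) ,
        ∨-least (∨-monotonic ≤-refl (≤-⋁-last e′ es b)) (≤-trans ⋁ds≤ (y≤x∨y e _))

      level-condition : LevelCondition b Δ′
      level-condition c d ds c◁d d-chain c≤⋁
        with atom-preimage (proj₁ (◁-atoms Δ′ c◁d)) | atom-preimage (proj₂ (◁-atoms Δ′ c◁d))
      ... | a , a-pre@(_ , _ , a∨b≡c) | e , e-pre with ◁-chain-preimage ds e-pre d-chain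
      ...   | es , e-chain , ⋁ds≤ = Δ-level-condition a e (es ++ [ b ]) (◁-preimage c◁d a-pre e-pre) e-chain
              (≤-trans (x≤x∨y a b) (≤-trans (≤-reflexive a∨b≡c) (≤-trans c≤⋁ ⋁ds≤)))

    x′-step : ∀ i → x′ (inject₁ i) ≡ x′ (suc i) ⊎ x′ (inject₁ i) ⋖ x′ (suc i)
    x′-step i = ⋖-∨ b (Δ-lm (suc (inject₁ i))) (Δ-cover (inject₁ i))

    LL-above : Σ ℕ λ k → Σ (Fin (suc k) → C) λ Δ′ → SameImage Δ′ x′ × IsLL b k Δ′
    LL-above = len , chain , image , (chain-first , trans last xₘ∨b≡⊤̂ , steps) , chain-lm ,
               LevelConditionAbove.level-condition chain (λ i → proj₁ (proj₁ (steps i))) chain-in-x′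
      where
      open Squashed (squash _⋖_ x′ x′-step)
      chain-in-x′ : ∀ j → ∃ λ i → x′ i ≡ chain j
      chain-in-x′ j = Equivalence.to (image (chain j)) (j , refl)
      chain-first : chain zero ≡ b
      chain-first = trans first (trans (cong (_∨ b) Δ-first) (x≤y⇒x∨y≈y (minimum b)))
      chain-lm : ∀ j → LeftModular b (chain j)
      chain-lm j with chain-in-x′ j
      ... | i , x′ᵢ≡chainⱼ = subst (LeftModular b) x′ᵢ≡chainⱼ (left-modular-∨ b (Δ-lm (inject₁ i)))

    Δ-below-xₘ : (j : Fin m) → Δ (suc (inject₁ j)) ≤ xₘ
    Δ-below-xₘ j = Δ-mono (≤⇒≤inject₁ (subst (suc (toℕ (inject₁ j)) ≤ⁿ_) (sym (toℕ-fromℕ m)) (inject₁ℕ< j)))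

    module _ (j : Fin m) where
      private
        x⁻ x⁺ : C
        x⁻ = Δ (inject₁ (inject₁ j))
        x⁺ = Δ (suc (inject₁ j))

      b⋖a∨b : ∀ {a} → Level ⊥̂ Δ (inject₁ j) a → Atom b (a ∨ b)
      b⋖a∨b {a} (a-atom , a≤x⁺ , a≰x⁻) = b<a∨b a-atom a≤xₘ , nothing-between
        where
        a≤xₘ : a ≤ xₘ
        a≤xₘ = ≤-trans a≤x⁺ (Δ-below-xₘ j)
        x⁻∧[a∨b]≡⊥̂ : x⁻ ∧ (a ∨ b) ≡ ⊥̂
        x⁻∧[a∨b]≡⊥̂ = meet-∨b≡⊥̂ _ a-atom a≤xₘ a≰x⁻
        nothing-between : ∀ w → ¬ ((b < w) × (w < a ∨ b))
        nothing-between w (b<w@(b≤w , _) , w<a∨b@(w≤a∨b , _))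
          with ⋖-∨-split (Δ-cover (inject₁ j)) (x∧y≤x x⁺ w)
        ... | inj₁ x⁺∧w≤x⁻ = left-modular-gap (Δ-lm (suc (inject₁ j))) b<w
                (≤-trans (∧-greatest x⁺∧w≤x⁻ (≤-trans (x∧y≤y x⁺ w) w≤a∨b)) (≡⊥̂⇒≤ x⁻∧[a∨b]≡⊥̂))
                (≤-trans w≤a∨b (∨-monotonic a≤x⁺ ≤-refl))
        ... | inj₂ x⁻∨[x⁺∧w]≡x⁺ = left-modular-gap (Δ-lm (inject₁ (inject₁ j))) w<a∨b
                (≡⊥̂⇒≤ x⁻∧[a∨b]≡⊥̂)
                (∨-least (≤-trans a≤x⁺ (≤-trans (≤-reflexive (sym x⁻∨[x⁺∧w]≡x⁺))
                                                (∨-monotonic ≤-refl (x∧y≤y x⁺ w))))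
                         (≤-trans b≤w (y≤x∨y x⁻ w)))

      level-∨b : ∀ {a} → Level ⊥̂ Δ (inject₁ j) a → Level b x′ j (a ∨ b)
      level-∨b a-level@(a-atom , a≤x⁺ , a≰x⁻) =
        b⋖a∨b a-level , ∨-monotonic a≤x⁺ ≤-refl ,
        a≰x⁻ ∘ ∨b-reflects-≤ _ a-atom (≤-trans a≤x⁺ (Δ-below-xₘ j))

      level-∧-∨b : ∀ {a} → Level ⊥̂ Δ (inject₁ j) a → x⁺ ∧ (a ∨ b) ≡ a
      level-∧-∨b {a} (a-atom , a≤x⁺ , a≰x⁻) = begin
        x⁺ ∧ (a ∨ b)          ≡⟨ cong (_∧ (a ∨ b)) (sym a∨x⁻≡x⁺) ⟩
        (a ∨ x⁻) ∧ (a ∨ b)    ≡⟨ sym (Δ-lm _ (a ∨ b) a (minimum _) (minimum a) (a<a∨b a-atom a≤xₘ)) ⟩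
        a ∨ (x⁻ ∧ (a ∨ b))    ≡⟨ cong (a ∨_) (meet-∨b≡⊥̂ _ a-atom a≤xₘ a≰x⁻) ⟩
        a ∨ ⊥̂                 ≡⟨ y≤x⇒x∨y≡x (minimum a) ⟩
        a                     ∎
        where
        open ≡-Reasoning
        a≤xₘ : a ≤ xₘ
        a≤xₘ = ≤-trans a≤x⁺ (Δ-below-xₘ j)
        a∨x⁻≡x⁺ : a ∨ x⁻ ≡ x⁺
        a∨x⁻≡x⁺ with ⋖-∨-split (Δ-cover (inject₁ j)) a≤x⁺
        ... | inj₁ a≤x⁻    = ⊥-elim (a≰x⁻ a≤x⁻)
        ... | inj₂ x⁻∨a≡x⁺ = trans (∨-comm a x⁻) x⁻∨a≡x⁺

      level-preimage : ∀ {c} → Level b x′ j c → ∃ λ a → Level ⊥̂ Δ (inject₁ j) a × a ∨ b ≡ c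
      level-preimage (c-atom , c≤x⁺∨b , c≰x⁻∨b)
        with atom-∨b-preimage (suc (inject₁ j)) (Δ-below-xₘ j) c-atom c≤x⁺∨b
      ... | a , a-atom , a≤x⁺ , refl =
        a , (a-atom , a≤x⁺ , λ a≤x⁻ → c≰x⁻∨b (∨-monotonic a≤x⁻ ≤-refl)) , refl

      level-count : count (level? ⊥̂ Δ (inject₁ j)) ≡ count (level? b x′ j)
      level-count = count-≡ (level? ⊥̂ Δ (inject₁ j)) (level? b x′ j) (_∨ b) (x⁺ ∧_)
                            level-∨b ∧-level level-∧-∨b ∧-level-∨b
        where
        ∧-level : ∀ {c} → Level b x′ j c → Level ⊥̂ Δ (inject₁ j) (x⁺ ∧ c)
        ∧-level c-level with level-preimage c-level
        ... | a , a-level , refl = subst (Level ⊥̂ Δ (inject₁ j)) (sym (level-∧-∨b a-level)) a-level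
        ∧-level-∨b : ∀ {c} → Level b x′ j c → (x⁺ ∧ c) ∨ b ≡ c
        ∧-level-∨b c-level with level-preimage c-level
        ... | a , a-level , refl = cong (_∨ b) (level-∧-∨b a-level)

lemma5p4 : (L : FinLattice) → let open LatticeNotions L in
    (m : ℕ) (Δ : Fin (suc (suc m)) → C) → IsLL ⊥̂ (suc m) Δ →
    (b : C) → Level ⊥̂ Δ (fromℕ m) b →
    let x′ : Fin (suc m) → C
        x′ i = Δ (inject₁ i) ∨ b
    in (Σ ℕ λ k → Σ (Fin (suc k) → C) λ Δ′ →
          (∀ y → (∃ λ j → Δ′ j ≡ y) ⇔ (∃ λ i → x′ i ≡ y)) × IsLL b k Δ′)
       × (∀ (j : Fin m) →
            count (level? ⊥̂ Δ (inject₁ j))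
              ≡ count (level? b x′ j))
lemma5p4 L m Δ Δ-LL b b-top = LL-above , level-count
  where open LatticeFacts.TopLevelAtom L m Δ Δ-LL b b-top
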